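{- Let $\epsilon\in(0,1]$. If $G$ is a bipartite $\epsilon$-expander with $2n$ vertices, then every separator in $G$ has size at least $\frac{\epsilon}{2}(n-1)-1$.
   Context: A bipartite graph $G$ with bipartition $A,B$ is a bipartite $\epsilon$-expander if $|A|=|B|$ and $|N(S)|\geq(1+\epsilon)|S|$ for every $S\subset A$ with $|S|\leq|A|/2$, where $N(S)$ is the set of vertices adjacent to some vertex of $S$. A separator in a graph $G$ is a set $Z\subseteq V(G)$ such that each component of $G-Z$ has at most $|V(G)|/2$ vertices. -}

module Defs where

open import Data.Nat as ℕ using (ℕ; zero; suc; _+_)
open import Data.Bool using (Bool; true; false; _∧_; _∨_)
open import Data.Fin using (Fin; zero; suc)
open import Data.Sum using (_⊎_; inj₁; inj₂)
open import Data.Product using (Σ; _×_; _,_; ∃)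
open import Data.Vec using (tabulate; lookup)
open import Data.Fin.Subset using (Subset; ∣_∣)
open import Data.Integer using (+_)
open import Data.Rational as ℚ using (ℚ; _/_; 1ℚ)
open import Relation.Binary.PropositionalEquality using (_≡_)
open import Function.Definitions using (Injective)
open import Data.Empty using (⊥)

toℚ : ℕ → ℚ
toℚ k = (+ k) / 1

anyFin : (n : ℕ) → (Fin n → Bool) → Bool
anyFin zero    p = false
anyFin (suc n) p = p zero ∨ anyFin n (λ i → p (suc i))

-- A bipartite graph with bipartition A = Fin n, B = Fin n (so |A| = |B| = n,
-- 2n vertices); E a b = true iff a ∈ A is adjacent to b ∈ B.
BipGraph : ℕ → Set
BipGraph n = Fin n → Fin n → Bool

N : ∀ {n} → BipGraph n → Subset n → Subset n
N {n} E S = tabulate (λ b → anyFin n (λ a → lookup S a ∧ E a b))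

IsBipExpander : ∀ {n} → ℚ → BipGraph n → Set
IsBipExpander {n} ε E =
  (S : Subset n) → toℚ ∣ S ∣ ℚ.≤ toℚ n ℚ.* ℚ.½ →
  (1ℚ ℚ.+ ε) ℚ.* toℚ ∣ S ∣ ℚ.≤ toℚ ∣ N E S ∣

V : ℕ → Set
V n = Fin n ⊎ Fin n

Adj : ∀ {n} → BipGraph n → V n → V n → Set
Adj E (inj₁ a) (inj₁ a') = ⊥
Adj E (inj₁ a) (inj₂ b)  = E a b ≡ true
Adj E (inj₂ b) (inj₁ a)  = E a b ≡ true
Adj E (inj₂ b) (inj₂ b') = ⊥

-- A vertex set Z ⊆ V(G) = A ⊎ B, given by its parts Z ∩ A and Z ∩ B.
VSet : ℕ → Set
VSet n = Subset n × Subset n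

size : ∀ {n} → VSet n → ℕ
size (ZA , ZB) = ∣ ZA ∣ + ∣ ZB ∣

notIn : ∀ {n} → VSet n → V n → Set
notIn (ZA , ZB) (inj₁ a) = lookup ZA a ≡ false
notIn (ZA , ZB) (inj₂ b) = lookup ZB b ≡ false

data Walk {n} (E : BipGraph n) (Z : VSet n) : V n → V n → Set where
  here : ∀ {v} → notIn Z v → Walk E Z v v
  step : ∀ {u w v} → notIn Z u → Adj E u w → Walk E Z w v → Walk E Z u v

-- Z is a separator: every component of G - Z has at most |V(G)|/2 = n
-- vertices, i.e. no component contains n+1 distinct vertices.
IsSeparator : ∀ {n} → BipGraph n → VSet n → Set
IsSeparator {n} E Z =
  (v : V n) (f : Fin (suc n) → V n) → Injective _≡_ _≡_ f →
  (∀ i → Walk E Z v (f i)) → ⊥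

-- Write h = ⌊n/2⌋ and call a vertex free if it is not in Z. Going through the free vertices of A
-- in order, let P be the union of the A-sides of the components of G - Z through the first k of
-- them, for the last k with |P| ≤ h, and let C be the component through the next one. If C has
-- more than h vertices in A, an h-subset of them has at least (1+ε)h neighbours, all in C or in
-- Z ∩ B; as C has at most n vertices, εh ≤ |Z ∩ B|. Otherwise A ∖ Z splits into P, (C ∩ A) ∖ P and
-- the rest, each of size at most h and each a union of A-sides of components, so their
-- neighbourhoods overlap only inside Z ∩ B, and expansion gives (1+ε)(n - |Z ∩ A|) ≤ n + 2|Z ∩ B|.
-- Either inequality implies the bound.

module Submission where

open import Defs
open import Data.Bool using (Bool)
open import Data.Fin using (Fin)
open import Data.Fin.Subset using (Subset; ∣_∣)
open import Data.Nat as ℕ using (ℕ)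
open import Data.Product using (_,_)
import Data.Rational as ℚ

module FiniteSets where

  import Data.Nat.Properties as ℕₚ
  open import Algebra.Properties.CommutativeSemigroup ℕₚ.+-commutativeSemigroup using (interchange)
  open import Algebra.Properties.Monoid.Sum ℕₚ.+-0-monoid using (sum; sum-cong-≗)
  open import Data.Bool using (true; false; T; T?; not; _∧_; _∨_)
  open import Data.Bool.Properties using (T-≡; T-∨; T-∧; T-not-≡)
  open import Data.Empty using (⊥; ⊥-elim)
  open import Data.Fin using (zero; suc)
  import Data.Fin.Properties as Finₚ
  import Data.Fin.Subset as Subset
  open import Data.Nat using (zero; suc; _+_; _≤_; _<_; z≤n; s≤s)
  open import Data.Product using (∃; ∃-syntax; _×_; _,_)
  open import Data.Sum using (_⊎_; inj₁; inj₂)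
  open import Data.Unit using (tt)
  open import Data.Vec as Vec using (_∷_; tabulate; here; there)
  open import Data.Vec.Functional using () renaming (_∷_ to _◂_)
  import Data.Vec.Properties as Vecₚ
  open import Function using (_∘_; Equivalence)
  open import Function.Definitions using (Injective)
  open import Relation.Binary.PropositionalEquality
  open import Relation.Nullary using (¬_; yes; no)
  open Equivalence using (to; from)

  𝒫 : ℕ → Set
  𝒫 n = Fin n → Bool

  infix 4 _∈_ _∉_ _⊆_
  infixr 6 _∪_ _─_

  _∈_ : ∀ {n} → Fin n → 𝒫 n → Set
  a ∈ X = T (X a)

  _∉_ : ∀ {n} → Fin n → 𝒫 n → Set
  a ∉ X = ¬ a ∈ X

  _⊆_ : ∀ {n} → 𝒫 n → 𝒫 n → Set
  X ⊆ Y = ∀ {a} → a ∈ X → a ∈ Y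

  ∅ : ∀ {n} → 𝒫 n
  ∅ _ = false

  _∪_ : ∀ {n} → 𝒫 n → 𝒫 n → 𝒫 n
  (X ∪ Y) a = X a ∨ Y a

  ∁ : ∀ {n} → 𝒫 n → 𝒫 n
  ∁ X a = not (X a)

  _─_ : ∀ {n} → 𝒫 n → 𝒫 n → 𝒫 n
  (X ─ Y) a = X a ∧ not (Y a)

  Disjoint : ∀ {n} → 𝒫 n → 𝒫 n → Set
  Disjoint X Y = ∀ {a} → a ∈ X → a ∈ Y → ⊥

  indicator : Bool → ℕ
  indicator true  = 1
  indicator false = 0

  card : ∀ {n} → 𝒫 n → ℕ
  card X = sum (λ a → indicator (X a))

  sum-mono-≤ : ∀ {n} {f g : Fin n → ℕ} → (∀ a → f a ≤ g a) → sum f ≤ sum g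
  sum-mono-≤ {zero}  f≤g = z≤n
  sum-mono-≤ {suc n} f≤g = ℕₚ.+-mono-≤ (f≤g zero) (sum-mono-≤ (f≤g ∘ suc))

  sum-mono-< : ∀ {n} {f g : Fin n → ℕ} → (∀ a → f a ≤ g a) → ∀ a → f a < g a → sum f < sum g
  sum-mono-< {suc n} f≤g zero    fa<ga = ℕₚ.+-mono-<-≤ fa<ga (sum-mono-≤ (f≤g ∘ suc))
  sum-mono-< {suc n} f≤g (suc a) fa<ga = ℕₚ.+-mono-≤-< (f≤g zero) (sum-mono-< (f≤g ∘ suc) a fa<ga)

  sum-distrib-+ : ∀ {n} (f g : Fin n → ℕ) → sum (λ a → f a + g a) ≡ sum f + sum g
  sum-distrib-+ {zero}  f g = refl
  sum-distrib-+ {suc n} f g =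
    trans (cong (f zero + g zero +_) (sum-distrib-+ (f ∘ suc) (g ∘ suc)))
          (interchange (f zero) (g zero) (sum (f ∘ suc)) (sum (g ∘ suc)))

  indicator-mono : ∀ {x y} → (T x → T y) → indicator x ≤ indicator y
  indicator-mono {false}         _   = z≤n
  indicator-mono {true}  {true}  _   = ℕₚ.≤-refl
  indicator-mono {true}  {false} x⇒y = ⊥-elim (x⇒y tt)

  indicator-∨ : ∀ x y → indicator (x ∨ y) ≤ indicator x + indicator y
  indicator-∨ true  y     = s≤s z≤n
  indicator-∨ false y     = ℕₚ.≤-refl

  indicator-disjoint-∨ : ∀ x y → (T x → T y → ⊥) → indicator x + indicator y ≤ indicator (x ∨ y)
  indicator-disjoint-∨ true  true  disj = ⊥-elim (disj tt tt)
  indicator-disjoint-∨ true  false disj = ℕₚ.≤-refl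
  indicator-disjoint-∨ false y     disj = ℕₚ.≤-refl

  card-mono-⊆ : ∀ {n} {X Y : 𝒫 n} → X ⊆ Y → card X ≤ card Y
  card-mono-⊆ {X = X} {Y} X⊆Y =
    sum-mono-≤ {f = indicator ∘ X} {indicator ∘ Y} (λ a → indicator-mono X⊆Y)

  card-mono-⊂ : ∀ {n} {X Y : 𝒫 n} → X ⊆ Y → ∀ {a} → a ∈ Y → a ∉ X → card X < card Y
  card-mono-⊂ {X = X} {Y} X⊆Y {a} a∈Y a∉X =
    sum-mono-< {f = indicator ∘ X} {indicator ∘ Y} (λ _ → indicator-mono X⊆Y) a
      (indicator-< (X a) (Y a) a∉X a∈Y)
    where
    indicator-< : ∀ x y → ¬ T x → T y → indicator x < indicator y
    indicator-< false true _  _ = s≤s z≤n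
    indicator-< true  _    ¬x _ = ⊥-elim (¬x tt)

  card-full : ∀ n → card {n} (λ _ → true) ≡ n
  card-full zero    = refl
  card-full (suc n) = cong suc (card-full n)

  card≤n : ∀ {n} (X : 𝒫 n) → card X ≤ n
  card≤n {n} X = subst (card X ≤_) (card-full n) (card-mono-⊆ {X = X} {λ _ → true} (λ _ → tt))

  card-∪ : ∀ {n} (X Y : 𝒫 n) → card (X ∪ Y) ≤ card X + card Y
  card-∪ X Y = subst (card (X ∪ Y) ≤_) (sum-distrib-+ (indicator ∘ X) (indicator ∘ Y))
    (sum-mono-≤ {f = indicator ∘ (X ∪ Y)} (λ a → indicator-∨ (X a) (Y a)))

  card-disjoint-∪ : ∀ {n} {X Y : 𝒫 n} → Disjoint X Y → card X + card Y ≤ card (X ∪ Y)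
  card-disjoint-∪ {X = X} {Y} disj =
    subst (_≤ card (X ∪ Y)) (sum-distrib-+ (indicator ∘ X) (indicator ∘ Y))
    (sum-mono-≤ {g = indicator ∘ (X ∪ Y)} (λ a → indicator-disjoint-∨ (X a) (Y a) disj))

  card-∅ : ∀ n → card {n} ∅ ≡ 0
  card-∅ zero    = refl
  card-∅ (suc n) = card-∅ n

  card-empty : ∀ {n} (X : 𝒫 n) → (∀ a → a ∉ X) → card X ≡ 0
  card-empty {n} X empty =
    ℕₚ.n≤0⇒n≡0 (subst (card X ≤_) (card-∅ n)
      (card-mono-⊆ {X = X} {∅} (λ {a} a∈X → ⊥-elim (empty a a∈X))))

  card-nonempty : ∀ {n} (X : 𝒫 n) → 0 < card X → ∃ (_∈ X)
  card-nonempty X 0<∣X∣ with Finₚ.any? (λ a → T? (X a))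
  ... | yes a∈X = a∈X
  ... | no  ∄a  = ⊥-elim (ℕₚ.<-irrefl (sym (card-empty X (λ a a∈X → ∄a (a , a∈X)))) 0<∣X∣)

  ⊆-of-card : ∀ {n} (X : 𝒫 n) {h} → h ≤ card X → ∃[ Y ] Y ⊆ X × card Y ≡ h
  ⊆-of-card {zero}  X {zero} _ = ∅ , (λ ()) , refl
  ⊆-of-card {suc n} X h≤∣X∣ with X zero in X₀≡
  ... | false =
    let Y , Y⊆X , ∣Y∣≡h = ⊆-of-card (X ∘ suc) h≤∣X∣
    in false ◂ Y , (λ { {suc a} a∈Y → Y⊆X a∈Y }) , ∣Y∣≡h
  ⊆-of-card {suc n} X {zero}  _             | true = ∅ , (λ ()) , card-∅ (suc n)
  ⊆-of-card {suc n} X {suc h} (s≤s h≤∣X∣) | true =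
    let Y , Y⊆X , ∣Y∣≡h = ⊆-of-card (X ∘ suc) h≤∣X∣
    in true ◂ Y , (λ { {zero} _ → subst T (sym X₀≡) tt ; {suc a} a∈Y → Y⊆X a∈Y }) , cong suc ∣Y∣≡h

  card-tabulate : ∀ {n} (X : 𝒫 n) → ∣ tabulate X ∣ ≡ card X
  card-tabulate {zero}  X = refl
  card-tabulate {suc n} X with X zero
  ... | true  = cong suc (card-tabulate (X ∘ suc))
  ... | false = card-tabulate (X ∘ suc)

  ∈-tabulate⁻ : ∀ {n} {X : 𝒫 n} {a} → a Subset.∈ tabulate X → a ∈ X
  ∈-tabulate⁻ {X = X} {a} a∈ = from T-≡ (trans (sym (Vecₚ.lookup∘tabulate X a)) (Vecₚ.[]=⇒lookup a∈))

  enum : ∀ {n} (p : Subset n) → Fin ∣ p ∣ → Fin n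
  enum (true  ∷ p) zero    = zero
  enum (true  ∷ p) (suc i) = suc (enum p i)
  enum (false ∷ p) i       = suc (enum p i)

  enum-∈ : ∀ {n} (p : Subset n) i → enum p i Subset.∈ p
  enum-∈ (true  ∷ p) zero    = here
  enum-∈ (true  ∷ p) (suc i) = there (enum-∈ p i)
  enum-∈ (false ∷ p) i       = there (enum-∈ p i)

  enum-injective : ∀ {n} (p : Subset n) → Injective _≡_ _≡_ (enum p)
  enum-injective (true  ∷ p) {zero}  {zero}  _  = refl
  enum-injective (true  ∷ p) {suc i} {suc j} eq = cong suc (enum-injective p (Finₚ.suc-injective eq))
  enum-injective (false ∷ p) eq = enum-injective p (Finₚ.suc-injective eq)

  anyFin⁺ : ∀ {n} (p : Fin n → Bool) a → T (p a) → T (anyFin n p)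
  anyFin⁺ p zero    pa = from T-∨ (inj₁ pa)
  anyFin⁺ p (suc a) pa = from T-∨ (inj₂ (anyFin⁺ (p ∘ suc) a pa))

  anyFin⁻ : ∀ {n} (p : Fin n → Bool) → T (anyFin n p) → ∃ λ a → T (p a)
  anyFin⁻ {suc n} p any with to T-∨ any
  ... | inj₁ p₀ = zero , p₀
  ... | inj₂ any′ = let a , pa = anyFin⁻ (p ∘ suc) any′ in suc a , pa

  anyFin-cong : ∀ {n} {p q : Fin n → Bool} → (∀ a → p a ≡ q a) → anyFin n p ≡ anyFin n q
  anyFin-cong {zero}  p≗q = refl
  anyFin-cong {suc n} p≗q = cong₂ _∨_ (p≗q zero) (anyFin-cong (p≗q ∘ suc))

  card-cong : ∀ {n} {X Y : 𝒫 n} → (∀ a → X a ≡ Y a) → card X ≡ card Y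
  card-cong X≗Y = sum-cong-≗ (cong indicator ∘ X≗Y)

  card≤card─+card : ∀ {n} (X S : 𝒫 n) → card X ≤ card (X ─ S) + card S
  card≤card─+card X S = ℕₚ.≤-trans (card-mono-⊆ {X = X} {(X ─ S) ∪ S} X⊆X─S∪S) (card-∪ (X ─ S) S)
    where
    X⊆X─S∪S : X ⊆ (X ─ S) ∪ S
    X⊆X─S∪S {a} a∈X with X a | S a
    X⊆X─S∪S {a} _  | true | true  = tt
    X⊆X─S∪S {a} _  | true | false = tt

  ∪-disjoint : ∀ {n} {X Y W : 𝒫 n} → Disjoint X W → Disjoint Y W → Disjoint (X ∪ Y) W
  ∪-disjoint {X = X} X#W Y#W {a} a∈X∪Y a∈W with X a in eq
  ... | true  = X#W (subst T (sym eq) tt) a∈W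
  ... | false = Y#W a∈X∪Y a∈W

  ∈-∪⁺ˡ : ∀ {n} {X Y : 𝒫 n} {a} → a ∈ X → a ∈ X ∪ Y
  ∈-∪⁺ˡ a∈X = from T-∨ (inj₁ a∈X)

  ∈-∪⁺ʳ : ∀ {n} {X Y : 𝒫 n} {a} → a ∈ Y → a ∈ X ∪ Y
  ∈-∪⁺ʳ {X = X} {a = a} a∈Y = from (T-∨ {X a}) (inj₂ a∈Y)

  ∈-∪⁻ : ∀ {n} (X Y : 𝒫 n) {a} → a ∈ X ∪ Y → a ∈ X ⊎ a ∈ Y
  ∈-∪⁻ X Y {a} = to (T-∨ {X a})

  ∈-─⁺ : ∀ {n} {X Y : 𝒫 n} {a} → a ∈ X → a ∉ Y → a ∈ X ─ Y
  ∈-─⁺ {Y = Y} {a} a∈X a∉Y with Y a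
  ... | true  = ⊥-elim (a∉Y tt)
  ... | false = from T-∧ (a∈X , tt)

  ∈-─⁻ : ∀ {n} (X Y : 𝒫 n) {a} → a ∈ X ─ Y → a ∈ X × a ∉ Y
  ∈-─⁻ X Y {a} a∈X─Y with to (T-∧ {X a}) a∈X─Y
  ... | a∈X , a∉Y = a∈X , λ a∈Y → subst T (to T-not-≡ a∉Y) a∈Y

  ─-monoˡ-⊆ : ∀ {n} {X Y S : 𝒫 n} → X ⊆ Y → X ─ S ⊆ Y ─ S
  ─-monoˡ-⊆ {X = X} {Y} {S} X⊆Y {a} a∈X─S =
    let a∈X , a∉S = ∈-─⁻ X S a∈X─S in ∈-─⁺ {X = Y} {S} (X⊆Y a∈X) a∉S

  ∈-∁⁺ : ∀ {n} {X : 𝒫 n} {a} → a ∉ X → a ∈ ∁ X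
  ∈-∁⁺ {X = X} {a} a∉X with X a
  ... | true  = ⊥-elim (a∉X tt)
  ... | false = tt

  card-lookup : ∀ {n} (p : Subset n) → card (Vec.lookup p) ≡ ∣ p ∣
  card-lookup p = trans (sym (card-tabulate (Vec.lookup p))) (cong ∣_∣ (Vecₚ.tabulate∘lookup p))

  card-cover : ∀ {n} (X₁ X₂ S : 𝒫 n) → n ≤ card X₁ + card (X₂ ─ X₁) + card (∁ S ─ X₂) + card S
  card-cover {n} X₁ X₂ S = begin
    n
      ≡⟨ card-full n ⟨
    card {n} (λ _ → true)
      ≤⟨ card-mono-⊆ {X = λ _ → true} {U} (λ {a} _ → covered a) ⟩
    card U
      ≤⟨ card-∪ _ S ⟩
    card ((X₁ ∪ (X₂ ─ X₁)) ∪ (∁ S ─ X₂)) + card S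
      ≤⟨ ℕₚ.+-monoˡ-≤ _ (card-∪ _ (∁ S ─ X₂)) ⟩
    card (X₁ ∪ (X₂ ─ X₁)) + card (∁ S ─ X₂) + card S
      ≤⟨ ℕₚ.+-monoˡ-≤ _ (ℕₚ.+-monoˡ-≤ _ (card-∪ X₁ (X₂ ─ X₁))) ⟩
    card X₁ + card (X₂ ─ X₁) + card (∁ S ─ X₂) + card S ∎
    where
    open ℕₚ.≤-Reasoning
    U = ((X₁ ∪ (X₂ ─ X₁)) ∪ (∁ S ─ X₂)) ∪ S
    covered : ∀ a → a ∈ U
    covered a with X₁ a | X₂ a | S a
    ... | true  | _     | _     = tt
    ... | false | true  | _     = tt
    ... | false | false | true  = tt
    ... | false | false | false = tt

module Closure {n : ℕ} (R : Fin n → Fin n → Bool) where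

  open FiniteSets
  open import Data.Bool using (T; T?; _∧_; _∨_)
  open import Data.Bool.Properties using (T-∧; T-∨)
  open import Data.Empty using (⊥-elim)
  import Data.Fin.Properties as Finₚ
  open import Data.Nat using (zero; suc; _≤_; _<_; z≤n; s≤s)
  import Data.Nat.Properties as ℕₚ
  open import Data.Product using (∃; _×_; _,_)
  open import Data.Sum as Sum using (_⊎_; inj₁; inj₂; [_,_]′)
  open import Function using (Equivalence)
  open import Relation.Nullary using (yes; no)
  open import Relation.Nullary.Decidable using (_×-dec_; ¬?)
  open Equivalence using (to; from)

  Closed : 𝒫 n → Set
  Closed X = ∀ {a a′} → a ∈ X → T (R a a′) → a′ ∈ X

  grow : 𝒫 n → 𝒫 n
  grow X a′ = X a′ ∨ anyFin n (λ a → X a ∧ R a a′)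

  ⊆-grow : ∀ {X} → X ⊆ grow X
  ⊆-grow a∈X = from T-∨ (inj₁ a∈X)

  grow⁺ : ∀ {X a a′} → a ∈ X → T (R a a′) → a′ ∈ grow X
  grow⁺ {X} {a} {a′} a∈X aRa′ =
    from T-∨ (inj₂ (anyFin⁺ (λ a → X a ∧ R a a′) a (from T-∧ (a∈X , aRa′))))

  grow⁻ : ∀ {X a′} → a′ ∈ grow X → a′ ∈ X ⊎ ∃ λ a → a ∈ X × T (R a a′)
  grow⁻ {X} {a′} a′∈ with to T-∨ a′∈
  ... | inj₁ a′∈X = inj₁ a′∈X
  ... | inj₂ any  = let a , p = anyFin⁻ (λ a → X a ∧ R a a′) any in inj₂ (a , to T-∧ p)

  grow-closed : ∀ {X} → Closed X → Closed (grow X)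
  grow-closed {X} X-closed a∈ aRa′ =
    ⊆-grow ([ (λ a∈X → X-closed a∈X aRa′) , (λ (b , b∈X , bRa) → X-closed (X-closed b∈X bRa) aRa′) ]′
              (grow⁻ a∈))

  -- If grow X adds no element, X itself is closed.
  grow-closed-or-grows : ∀ X → Closed (grow X) ⊎ card X < card (grow X)
  grow-closed-or-grows X with Finₚ.any? (λ a → T? (grow X a) ×-dec ¬? (T? (X a)))
  ... | yes (a , a∈ , a∉) = inj₂ (card-mono-⊂ {X = X} ⊆-grow a∈ a∉)
  ... | no ∄new = inj₁ (grow-closed X-closed)
    where
    X-closed : Closed X
    X-closed {a} {a′} a∈X aRa′ with T? (X a′)
    ... | yes a′∈X = a′∈X
    ... | no  a′∉X = ⊥-elim (∄new (a′ , grow⁺ a∈X aRa′ , a′∉X))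

  grows : ℕ → 𝒫 n → 𝒫 n
  grows zero    X = X
  grows (suc j) X = grow (grows j X)

  grows-closed-or-large : ∀ X j → Closed (grows j X) ⊎ j ≤ card (grows j X)
  grows-closed-or-large X zero = inj₂ z≤n
  grows-closed-or-large X (suc j) with grows-closed-or-large X j
  ... | inj₁ closed = inj₁ (grow-closed closed)
  ... | inj₂ j≤∣Y∣  = Sum.map₂ (ℕₚ.≤-trans (s≤s j≤∣Y∣)) (grow-closed-or-grows (grows j X))

  -- Until it is closed, each step adds an element; there are only n, so n + 1 steps suffice.
  closure : 𝒫 n → 𝒫 n
  closure X = grows (suc n) X

  closure-closed : ∀ X → Closed (closure X)
  closure-closed X with grows-closed-or-large X (suc n)
  ... | inj₁ closed   = closed
  ... | inj₂ n<∣cl∣ = ⊥-elim (ℕₚ.1+n≰n (ℕₚ.≤-trans n<∣cl∣ (card≤n (closure X))))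

  ⊆-closure : ∀ {X} → X ⊆ closure X
  ⊆-closure {X} = ⊆-grows (suc n)
    where
    ⊆-grows : ∀ j → X ⊆ grows j X
    ⊆-grows zero    a∈X = a∈X
    ⊆-grows (suc j) a∈X = ⊆-grow (⊆-grows j a∈X)

  closure-ind : ∀ {ℓ} (Q : Fin n → Set ℓ) {X} → (∀ {a} → a ∈ X → Q a) →
    (∀ {a a′} → Q a → T (R a a′) → Q a′) → ∀ {a} → a ∈ closure X → Q a
  closure-ind Q {X} base extend = grows-ind (suc n)
    where
    grows-ind : ∀ j {a} → a ∈ grows j X → Q a
    grows-ind zero    a∈ = base a∈
    grows-ind (suc j) a∈ =
      [ grows-ind j , (λ (a , a∈ , aRa′) → extend (grows-ind j a∈) aRa′) ]′ (grow⁻ a∈)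

  closure-least : ∀ {X Y} → Closed Y → X ⊆ Y → closure X ⊆ Y
  closure-least {Y = Y} Y-closed X⊆Y = closure-ind (_∈ Y) X⊆Y Y-closed

  ∪-closed : ∀ {X Y} → Closed X → Closed Y → Closed (X ∪ Y)
  ∪-closed X-closed Y-closed a∈ aRa′ =
    from T-∨ (Sum.map (λ a∈X → X-closed a∈X aRa′) (λ a∈Y → Y-closed a∈Y aRa′) (to T-∨ a∈))

module SeparatedGraph {n : ℕ} (E : BipGraph n) (ZA ZB : Subset n) where

  open FiniteSets
  open import Data.Bool using (T; _∧_)
  open import Data.Bool.Properties using (T-∧; T-not-≡; T-≡)
  open import Data.Empty using (⊥-elim)
  open import Data.Fin using (toℕ; splitAt; join; inject≤)
  import Data.Fin.Properties as Finₚ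
  open import Data.Nat using (zero; suc; _+_; _≤_; _<_; _≤?_; _≡ᵇ_)
  import Data.Nat.Properties as ℕₚ
  open import Data.Nat.Solver using (module +-*-Solver)
  open import Data.Product using (∃; _×_; proj₁; proj₂)
  open import Data.Sum as Sum using (inj₁; inj₂)
  open import Data.Sum.Properties using (inj₁-injective; inj₂-injective)
  open import Data.Vec using (lookup; tabulate)
  import Data.Vec.Properties as Vecₚ
  open import Function using (_∘_; Equivalence)
  open import Function.Definitions using (Injective)
  open import Relation.Binary.PropositionalEquality
  open import Relation.Nullary using (yes; no)
  open Equivalence using (to; from)

  Z : VSet n
  Z = ZA , ZB

  ZAᶠ ZBᶠ freeA freeB : 𝒫 n
  ZAᶠ = lookup ZA
  ZBᶠ = lookup ZB
  freeA = ∁ ZAᶠ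
  freeB = ∁ ZBᶠ

  infixl 5 _▷_
  _▷_ : ∀ {u v w} → Walk E Z u v → Adj E v w × notIn Z w → Walk E Z u w
  here u∉Z       ▷ (vw , w∉Z) = step u∉Z vw (here w∉Z)
  step u∉Z uu′ W ▷ vw,w∉Z     = step u∉Z uu′ (W ▷ vw,w∉Z)

  separator-bound : IsSeparator E Z → ∀ v (X Y : 𝒫 n) →
    (∀ {a} → a ∈ X → Walk E Z v (inj₁ a)) → (∀ {b} → b ∈ Y → Walk E Z v (inj₂ b)) →
    card X + card Y ≤ n
  separator-bound separator v X Y reachX reachY with card X + card Y ≤? n
  ... | yes ≤n = ≤n
  ... | no  ≰n = ⊥-elim (separator v f f-injective (reach ∘ split))
    where
    p = tabulate X
    q = tabulate Y
    n<∣p∣+∣q∣ : suc n ≤ ∣ p ∣ + ∣ q ∣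
    n<∣p∣+∣q∣ rewrite card-tabulate X | card-tabulate Y = ℕₚ.≰⇒> ≰n
    split : Fin (suc n) → Fin ∣ p ∣ Sum.⊎ Fin ∣ q ∣
    split i = splitAt ∣ p ∣ (inject≤ i n<∣p∣+∣q∣)
    split-injective : Injective _≡_ _≡_ split
    split-injective {i} {j} eq = Finₚ.inject≤-injective n<∣p∣+∣q∣ n<∣p∣+∣q∣ i j
      (trans (sym (Finₚ.join-splitAt ∣ p ∣ ∣ q ∣ _))
             (trans (cong (join ∣ p ∣ ∣ q ∣) eq) (Finₚ.join-splitAt ∣ p ∣ ∣ q ∣ _)))
    pick : Fin ∣ p ∣ Sum.⊎ Fin ∣ q ∣ → V n
    pick = Sum.map (enum p) (enum q)
    pick-injective : Injective _≡_ _≡_ pick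
    pick-injective {inj₁ i} {inj₁ j} eq = cong inj₁ (enum-injective p (inj₁-injective eq))
    pick-injective {inj₂ i} {inj₂ j} eq = cong inj₂ (enum-injective q (inj₂-injective eq))
    f : Fin (suc n) → V n
    f = pick ∘ split
    f-injective : Injective _≡_ _≡_ f
    f-injective = split-injective ∘ pick-injective
    reach : ∀ u → Walk E Z v (pick u)
    reach (inj₁ i) = reachX (∈-tabulate⁻ (enum-∈ p i))
    reach (inj₂ j) = reachY (∈-tabulate⁻ (enum-∈ q j))

  -- Closing a set of A-vertices outside ZA under linked gives the A-side of the union of the
  -- components of G - Z that meet it.
  linked : Fin n → Fin n → Bool
  linked a a′ = freeA a′ ∧ anyFin n (λ b → freeB b ∧ (E a b ∧ E a′ b))

  open Closure linked public

  𝒩 : 𝒫 n → 𝒫 n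
  𝒩 X b = anyFin n (λ a → X a ∧ E a b)

  card-N : ∀ X → ∣ N E (tabulate X) ∣ ≡ card (𝒩 X)
  card-N X = trans (card-tabulate (λ b → anyFin n (λ a → lookup (tabulate X) a ∧ E a b)))
    (card-cong (λ b → anyFin-cong (λ a → cong (_∧ E a b) (Vecₚ.lookup∘tabulate X a))))

  linked⁺ : ∀ {a a′ b} → a′ ∈ freeA → b ∈ freeB → T (E a b) → T (E a′ b) → T (linked a a′)
  linked⁺ {a} {a′} {b} a′-free b-free ab a′b =
    from T-∧ (a′-free , anyFin⁺ (λ b → freeB b ∧ (E a b ∧ E a′ b)) b
                          (from T-∧ (b-free , from T-∧ (ab , a′b))))

  linked⁻ : ∀ {a a′} → T (linked a a′) → a′ ∈ freeA × ∃ λ b → b ∈ freeB × T (E a b) × T (E a′ b)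
  linked⁻ {a} {a′} aLa′ =
    let a′-free , common = to (T-∧ {freeA a′}) aLa′
        b , b-free∧edges = anyFin⁻ (λ b → freeB b ∧ (E a b ∧ E a′ b)) common
        b-free , edges = to (T-∧ {freeB b}) b-free∧edges
    in a′-free , b , b-free , to (T-∧ {E a b}) edges

  ∈-𝒩⁻ : ∀ {X b} → b ∈ 𝒩 X → ∃ λ a → a ∈ X × T (E a b)
  ∈-𝒩⁻ {X} {b} b∈𝒩X =
    let a , a∈X∧ab = anyFin⁻ (λ a → X a ∧ E a b) b∈𝒩X in a , to (T-∧ {X a}) a∈X∧ab

  ∈-𝒩⁺ : ∀ {X a b} → a ∈ X → T (E a b) → b ∈ 𝒩 X
  ∈-𝒩⁺ {X} {a} {b} a∈X ab = anyFin⁺ (λ a → X a ∧ E a b) a (from T-∧ (a∈X , ab))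

  walk-linked : ∀ {v a a′} → Walk E Z v (inj₁ a) → T (linked a a′) → Walk E Z v (inj₁ a′)
  walk-linked W aLa′ with linked⁻ aLa′
  ... | a′-free , b , b-free , ab , a′b =
    _▷_ {w = inj₂ b} W (to T-≡ ab , to T-not-≡ b-free) ▷ (to T-≡ a′b , to T-not-≡ a′-free)

  freeA-closed : Closed freeA
  freeA-closed {a′ = a′} _ aLa′ = proj₁ (to (T-∧ {freeA a′}) aLa′)

  𝒩-disjoint : ∀ {X Y Y′} → Closed X → Y ⊆ X → Y′ ⊆ freeA ─ X → Disjoint (𝒩 Y ─ ZBᶠ) (𝒩 Y′ ─ ZBᶠ)
  𝒩-disjoint {X} {Y} {Y′} X-closed Y⊆X Y′⊆freeA─X {b} b∈𝒩Y─ZB b∈𝒩Y′─ZB =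
    let b∈𝒩Y , b∉ZB = ∈-─⁻ (𝒩 Y) ZBᶠ b∈𝒩Y─ZB
        a , a∈Y , ab = ∈-𝒩⁻ b∈𝒩Y
        a′ , a′∈Y′ , a′b = ∈-𝒩⁻ (proj₁ (∈-─⁻ (𝒩 Y′) ZBᶠ b∈𝒩Y′─ZB))
        a′-free , a′∉X = ∈-─⁻ freeA X (Y′⊆freeA─X a′∈Y′)
    in a′∉X (X-closed (Y⊆X a∈Y) (linked⁺ a′-free (∈-∁⁺ {X = ZBᶠ} b∉ZB) ab a′b))

  seed : ℕ → 𝒫 n
  seed k a = (toℕ a ≡ᵇ k) ∧ freeA a

  component : ℕ → 𝒫 n
  component k = closure (seed k)

  seed⊆freeA : ∀ k → seed k ⊆ freeA
  seed⊆freeA k {a} a∈seed = proj₂ (to (T-∧ {toℕ a ≡ᵇ k}) a∈seed)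

  seed-index : ∀ {k a} → a ∈ seed k → toℕ a ≡ k
  seed-index {k} {a} a∈seed = ℕₚ.≡ᵇ⇒≡ (toℕ a) k (proj₁ (to (T-∧ {toℕ a ≡ᵇ k}) a∈seed))

  ∈-seed-toℕ : ∀ {a} → a ∈ freeA → a ∈ seed (toℕ a)
  ∈-seed-toℕ {a} a-free = from T-∧ (ℕₚ.≡⇒≡ᵇ (toℕ a) (toℕ a) refl , a-free)

  component-connected : ∀ {k r a} → r ∈ seed k → a ∈ component k → Walk E Z (inj₁ r) (inj₁ a)
  component-connected {k} {r} r∈seed = closure-ind (λ a → Walk E Z (inj₁ r) (inj₁ a)) from-seed walk-linked
    where
    from-seed : ∀ {a} → a ∈ seed k → Walk E Z (inj₁ r) (inj₁ a)
    from-seed a∈seed rewrite Finₚ.toℕ-injective (trans (seed-index a∈seed) (sym (seed-index r∈seed))) =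
      here (to T-not-≡ (seed⊆freeA k r∈seed))

  component-seeded : ∀ {k a} → a ∈ component k → ∃ (_∈ seed k)
  component-seeded {k} = closure-ind (λ _ → ∃ (_∈ seed k)) (λ a∈seed → _ , a∈seed) (λ r∈seed _ → r∈seed)

  prefix : ℕ → 𝒫 n
  prefix zero    = ∅
  prefix (suc k) = prefix k ∪ component k

  prefix-closed : ∀ k → Closed (prefix k)
  prefix-closed zero    ()
  prefix-closed (suc k) = ∪-closed (prefix-closed k) (closure-closed (seed k))

  prefix⊆freeA : ∀ k → prefix k ⊆ freeA
  prefix⊆freeA zero    ()
  prefix⊆freeA (suc k) {a} a∈ with ∈-∪⁻ (prefix k) (component k) a∈
  ... | inj₁ a∈prefix    = prefix⊆freeA k a∈prefix
  ... | inj₂ a∈component = closure-least freeA-closed (seed⊆freeA k) a∈component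

  freeA⊆prefix : ∀ k {a} → toℕ a < k → a ∈ freeA → a ∈ prefix k
  freeA⊆prefix (suc k) {a} a<1+k a-free with ℕₚ.m<1+n⇒m<n∨m≡n a<1+k
  ... | inj₁ a<k  = ∈-∪⁺ˡ {X = prefix k} {component k} (freeA⊆prefix k a<k a-free)
  ... | inj₂ refl = ∈-∪⁺ʳ {X = prefix k} {component k} (⊆-closure {seed k} (∈-seed-toℕ a-free))

  card-𝒩─ZB-three-parts : ∀ {X₁ X₂} → Closed X₁ → Closed X₂ → X₁ ⊆ X₂ → X₂ ⊆ freeA →
    card (𝒩 X₁ ─ ZBᶠ) + card (𝒩 (X₂ ─ X₁) ─ ZBᶠ) + card (𝒩 (freeA ─ X₂) ─ ZBᶠ) + card ZBᶠ ≤ n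
  card-𝒩─ZB-three-parts {X₁} {X₂} X₁-closed X₂-closed X₁⊆X₂ X₂⊆freeA = begin
    card D₁ + card D₂ + card D₃ + card ZBᶠ
      ≤⟨ ℕₚ.+-monoˡ-≤ _ (ℕₚ.+-monoˡ-≤ _ (card-disjoint-∪ {X = D₁} D₁#D₂)) ⟩
    card (D₁ ∪ D₂) + card D₃ + card ZBᶠ
      ≤⟨ ℕₚ.+-monoˡ-≤ _ (card-disjoint-∪ {X = D₁ ∪ D₂} D₁∪D₂#D₃) ⟩
    card ((D₁ ∪ D₂) ∪ D₃) + card ZBᶠ
      ≤⟨ card-disjoint-∪ {X = (D₁ ∪ D₂) ∪ D₃} D₁∪D₂∪D₃#ZB ⟩
    card (((D₁ ∪ D₂) ∪ D₃) ∪ ZBᶠ)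
      ≤⟨ card≤n _ ⟩
    n ∎
    where
    open ℕₚ.≤-Reasoning
    D₁ = 𝒩 X₁ ─ ZBᶠ
    D₂ = 𝒩 (X₂ ─ X₁) ─ ZBᶠ
    D₃ = 𝒩 (freeA ─ X₂) ─ ZBᶠ
    ─ZB#ZB : ∀ Y → Disjoint (Y ─ ZBᶠ) ZBᶠ
    ─ZB#ZB Y b∈Y─ZB b∈ZB = proj₂ (∈-─⁻ Y ZBᶠ b∈Y─ZB) b∈ZB
    D₁#D₂ : Disjoint D₁ D₂
    D₁#D₂ = 𝒩-disjoint X₁-closed (λ a∈X₁ → a∈X₁)
      (λ a∈X₂─X₁ → let a∈X₂ , a∉X₁ = ∈-─⁻ X₂ X₁ a∈X₂─X₁
                   in ∈-─⁺ {X = freeA} {X₁} (X₂⊆freeA a∈X₂) a∉X₁)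
    D₁∪D₂#D₃ : Disjoint (D₁ ∪ D₂) D₃
    D₁∪D₂#D₃ = ∪-disjoint {X = D₁} (𝒩-disjoint X₂-closed X₁⊆X₂ (λ a∈ → a∈))
                                   (𝒩-disjoint X₂-closed (λ a∈ → proj₁ (∈-─⁻ X₂ X₁ a∈)) (λ a∈ → a∈))
    D₁∪D₂∪D₃#ZB : Disjoint ((D₁ ∪ D₂) ∪ D₃) ZBᶠ
    D₁∪D₂∪D₃#ZB = ∪-disjoint {X = D₁ ∪ D₂}
      (∪-disjoint {X = D₁} (─ZB#ZB (𝒩 X₁)) (─ZB#ZB (𝒩 (X₂ ─ X₁)))) (─ZB#ZB (𝒩 (freeA ─ X₂)))

  card-𝒩-three-parts : ∀ {X₁ X₂} → Closed X₁ → Closed X₂ → X₁ ⊆ X₂ → X₂ ⊆ freeA →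
    card (𝒩 X₁) + card (𝒩 (X₂ ─ X₁)) + card (𝒩 (freeA ─ X₂)) ≤ n + card ZBᶠ + card ZBᶠ
  card-𝒩-three-parts {X₁} {X₂} X₁-closed X₂-closed X₁⊆X₂ X₂⊆freeA = begin
    card (𝒩 X₁) + card (𝒩 (X₂ ─ X₁)) + card (𝒩 (freeA ─ X₂))
      ≤⟨ ℕₚ.+-mono-≤ (ℕₚ.+-mono-≤ (card≤card─+card _ ZBᶠ) (card≤card─+card _ ZBᶠ))
                     (card≤card─+card _ ZBᶠ) ⟩
    (d₁ + zB) + (d₂ + zB) + (d₃ + zB)
      ≡⟨ solve 4 (λ d₁ d₂ d₃ zB → (d₁ :+ zB) :+ (d₂ :+ zB) :+ (d₃ :+ zB)
                                 := d₁ :+ d₂ :+ d₃ :+ zB :+ zB :+ zB) refl d₁ d₂ d₃ zB ⟩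
    d₁ + d₂ + d₃ + zB + zB + zB
      ≤⟨ ℕₚ.+-monoˡ-≤ zB (ℕₚ.+-monoˡ-≤ zB
           (card-𝒩─ZB-three-parts X₁-closed X₂-closed X₁⊆X₂ X₂⊆freeA)) ⟩
    n + zB + zB ∎
    where
    open ℕₚ.≤-Reasoning
    open +-*-Solver using (solve; _:+_; _:=_)
    d₁ = card (𝒩 X₁ ─ ZBᶠ)
    d₂ = card (𝒩 (X₂ ─ X₁) ─ ZBᶠ)
    d₃ = card (𝒩 (freeA ─ X₂) ─ ZBᶠ)
    zB = card ZBᶠ

  𝒩-mono : ∀ {X Y} → X ⊆ Y → 𝒩 X ⊆ 𝒩 Y
  𝒩-mono X⊆Y b∈𝒩X = let a , a∈X , ab = ∈-𝒩⁻ b∈𝒩X in ∈-𝒩⁺ (X⊆Y a∈X) ab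

  -- A nonempty component and its neighbours outside ZB lie in one component of G - Z.
  component-bound : IsSeparator E Z → ∀ {k a} → a ∈ component k →
    card (component k) + card (𝒩 (component k) ─ ZBᶠ) ≤ n
  component-bound separator {k} a∈C =
    let r , r∈seed = component-seeded a∈C
    in separator-bound separator (inj₁ r) (component k) (𝒩 (component k) ─ ZBᶠ)
         (component-connected r∈seed) (reach-neighbour r∈seed)
    where
    reach-neighbour : ∀ {r b} → r ∈ seed k → b ∈ 𝒩 (component k) ─ ZBᶠ → Walk E Z (inj₁ r) (inj₂ b)
    reach-neighbour r∈seed b∈ =
      let b∈𝒩C , b∉ZB = ∈-─⁻ (𝒩 (component k)) ZBᶠ b∈
          a , a∈C , ab = ∈-𝒩⁻ b∈𝒩C
      in component-connected r∈seed a∈C ▷ (to T-≡ ab , to T-not-≡ (∈-∁⁺ {X = ZBᶠ} b∉ZB))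

  prefix-step⊆component : ∀ k → prefix (suc k) ─ prefix k ⊆ component k
  prefix-step⊆component k a∈ with ∈-─⁻ (prefix (suc k)) (prefix k) a∈
  ... | a∈P∪C , a∉P with ∈-∪⁻ (prefix k) (component k) a∈P∪C
  ...   | inj₁ a∈P = ⊥-elim (a∉P a∈P)
  ...   | inj₂ a∈C = a∈C

module NatSearch where

  open import Data.Nat using (zero; suc)
  open import Data.Product using (∃; _×_; _,_)
  open import Data.Sum using (_⊎_; inj₁; inj₂)
  open import Relation.Binary.PropositionalEquality using (_≡_; refl)
  open import Relation.Nullary using (¬_; yes; no)
  open import Relation.Unary using (Pred; Decidable)

  last-before-failure : ∀ {ℓ} (P : Pred ℕ ℓ) → Decidable P → P 0 →
    ∀ m → ∃ λ k → P k × (¬ P (suc k) ⊎ k ≡ m)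
  last-before-failure P P? P0 zero = 0 , P0 , inj₂ refl
  last-before-failure P P? P0 (suc m) with last-before-failure P P? P0 m
  ... | k , Pk , inj₁ ¬Pk+1 = k , Pk , inj₁ ¬Pk+1
  ... | k , Pk , inj₂ refl with P? (suc k)
  ...   | yes Pk+1 = suc k , Pk+1 , inj₂ refl
  ...   | no ¬Pk+1 = k , Pk , inj₁ ¬Pk+1

module RationalBounds where

  open import Data.Nat.Coprimality using (1-coprimeTo) renaming (sym to coprime-sym)
  open import Data.Integer as ℤ using (+_)
  import Data.Integer.Properties as ℤₚ
  open import Data.Rational using (ℚ; 0ℚ; 1ℚ; ½; _≤_; _*_; _-_; _+_; _/_; mkℚ; -_; *≤*; nonNegative)
  import Data.Rational.Properties as ℚₚ
  open import Data.Rational.Solver using (module +-*-Solver)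
  open import Relation.Binary.PropositionalEquality
  open +-*-Solver

  toℚ≡mkℚ : ∀ k → toℚ k ≡ mkℚ (+ k) 0 (coprime-sym (1-coprimeTo k))
  toℚ≡mkℚ k = ℚₚ.↥p/↧p≡p (mkℚ (+ k) 0 (coprime-sym (1-coprimeTo k)))

  toℚ-+ : ∀ a b → toℚ (a ℕ.+ b) ≡ toℚ a + toℚ b
  toℚ-+ a b rewrite toℚ≡mkℚ a | toℚ≡mkℚ b =
    cong (_/ 1) (cong₂ ℤ._+_ (sym (ℤₚ.*-identityʳ (+ a))) (sym (ℤₚ.*-identityʳ (+ b))))

  toℚ-mono-≤ : ∀ {a b} → a ℕ.≤ b → toℚ a ≤ toℚ b
  toℚ-mono-≤ {a} {b} a≤b rewrite toℚ≡mkℚ a | toℚ≡mkℚ b =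
    *≤* (subst₂ ℤ._≤_ (sym (ℤₚ.*-identityʳ (+ a))) (sym (ℤₚ.*-identityʳ (+ b))) (ℤ.+≤+ a≤b))

  0≤q-p : ∀ {p q} → p ≤ q → 0ℚ ≤ q - p
  0≤q-p {p} {q} p≤q = subst (_≤ q - p) (ℚₚ.+-inverseʳ p) (ℚₚ.+-monoˡ-≤ (- p) p≤q)

  0≤p*q : ∀ {p q} → 0ℚ ≤ p → 0ℚ ≤ q → 0ℚ ≤ p * q
  0≤p*q {p} {q} 0≤p 0≤q =
    ℚₚ.nonNegative⁻¹ (p * q) {{ℚₚ.nonNeg*nonNeg⇒nonNeg p {{nonNegative 0≤p}} q {{nonNegative 0≤q}}}}

  -- The two bounds below are proved by writing the difference of their sides as a sum d of terms
  -- that are nonnegative by the hypotheses; the ring solver checks the identity.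
  ≤-by-slack : ∀ {p q} d → 0ℚ ≤ d → p + d ≡ q → p ≤ q
  ≤-by-slack {p} d 0≤d refl = subst (_≤ p + d) (ℚₚ.+-identityʳ p) (ℚₚ.+-monoʳ-≤ p 0≤d)

  scaled-toℚ-+ : ∀ λ′ {a b c d} → λ′ * toℚ a ≤ toℚ b → λ′ * toℚ c ≤ toℚ d →
    λ′ * toℚ (a ℕ.+ c) ≤ toℚ (b ℕ.+ d)
  scaled-toℚ-+ λ′ {a} {b} {c} {d} ab cd rewrite toℚ-+ a c | toℚ-+ b d =
    subst (_≤ toℚ b + toℚ d) (sym (ℚₚ.*-distribˡ-+ λ′ (toℚ a) (toℚ c))) (ℚₚ.+-mono-≤ ab cd)

  half-≤ : ∀ {p q} → p + p ≤ q → p ≤ q * ½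
  half-≤ {p} {q} 2p≤q = ≤-by-slack (½ * (q - (p + p))) (0≤p*q (ℚₚ.nonNegative⁻¹ ½) (0≤q-p 2p≤q))
    (solve 2 (λ p q → p :+ con ½ :* (q :- (p :+ p)) := q :* con ½) refl p q)

  bound-from-large-component : ∀ ε n h c zA zB → 0ℚ ≤ ε →
    (1ℚ + ε) * toℚ h ≤ toℚ c → c ℕ.+ h ℕ.+ 1 ℕ.≤ n ℕ.+ zB → n ℕ.≤ h ℕ.+ h ℕ.+ 1 →
    (ε * ½) * (toℚ n - 1ℚ) - 1ℚ ≤ toℚ zA + toℚ zB
  bound-from-large-component ε n h c zA zB 0≤ε expand separate n≤2h+1 =
    ≤-by-slack slack 0≤slack (solve 6 (λ ε n h c zA zB →
      (ε :* con ½) :* (n :- con 1ℚ) :- con 1ℚ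
        :+ (zA :+ ((n :+ zB) :- (c :+ h :+ con 1ℚ)) :+ (c :- (con 1ℚ :+ ε) :* h)
            :+ ((h :+ h :+ con 1ℚ) :- n) :+ (ε :* con ½) :* ((h :+ h :+ con 1ℚ) :- n) :+ con 1ℚ)
      := zA :+ zB) refl ε (toℚ n) (toℚ h) (toℚ c) (toℚ zA) (toℚ zB))
    where
    qn = toℚ n
    qh = toℚ h
    qc = toℚ c
    separate′ : qc + qh + 1ℚ ≤ qn + toℚ zB
    separate′ = subst₂ _≤_ (trans (toℚ-+ (c ℕ.+ h) 1) (cong (_+ 1ℚ) (toℚ-+ c h))) (toℚ-+ n zB)
                  (toℚ-mono-≤ separate)
    n≤2h+1′ : qn ≤ qh + qh + 1ℚ
    n≤2h+1′ = subst (qn ≤_) (trans (toℚ-+ (h ℕ.+ h) 1) (cong (_+ 1ℚ) (toℚ-+ h h))) (toℚ-mono-≤ n≤2h+1)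
    slack = toℚ zA + ((qn + toℚ zB) - (qc + qh + 1ℚ)) + (qc - (1ℚ + ε) * qh)
            + ((qh + qh + 1ℚ) - qn) + (ε * ½) * ((qh + qh + 1ℚ) - qn) + 1ℚ
    0≤slack : 0ℚ ≤ slack
    0≤slack = ℚₚ.+-mono-≤ (ℚₚ.+-mono-≤ (ℚₚ.+-mono-≤ (ℚₚ.+-mono-≤ (ℚₚ.+-mono-≤
      (toℚ-mono-≤ {0} {zA} ℕ.z≤n) (0≤q-p separate′)) (0≤q-p expand)) (0≤q-p n≤2h+1′))
      (0≤p*q (0≤p*q 0≤ε (ℚₚ.nonNegative⁻¹ ½)) (0≤q-p n≤2h+1′))) (ℚₚ.nonNegative⁻¹ 1ℚ)

  bound-from-small-parts : ∀ ε n g m zA zB → 0ℚ ≤ ε → ε ≤ 1ℚ →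
    (1ℚ + ε) * toℚ g ≤ toℚ m → n ℕ.≤ g ℕ.+ zA → m ℕ.≤ n ℕ.+ zB ℕ.+ zB →
    (ε * ½) * (toℚ n - 1ℚ) - 1ℚ ≤ toℚ zA + toℚ zB
  bound-from-small-parts ε n g m zA zB 0≤ε ε≤1 expand cover neighbours =
    ≤-by-slack (½ * slack) (0≤p*q (ℚₚ.nonNegative⁻¹ ½) 0≤slack) (solve 6 (λ ε n g m zA zB →
      (ε :* con ½) :* (n :- con 1ℚ) :- con 1ℚ
        :+ con ½ :* (((n :+ zB :+ zB) :- m) :+ (m :- (con 1ℚ :+ ε) :* g) :+ ((g :+ zA) :- n)
                     :+ ε :* ((g :+ zA) :- n) :+ (con 1ℚ :- ε) :* zA :+ ε :+ (con 1ℚ :+ con 1ℚ))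
      := zA :+ zB) refl ε (toℚ n) (toℚ g) (toℚ m) (toℚ zA) (toℚ zB))
    where
    qn = toℚ n
    qg = toℚ g
    qm = toℚ m
    qzA = toℚ zA
    qzB = toℚ zB
    cover′ : qn ≤ qg + qzA
    cover′ = subst (qn ≤_) (toℚ-+ g zA) (toℚ-mono-≤ cover)
    neighbours′ : qm ≤ qn + qzB + qzB
    neighbours′ = subst (qm ≤_) (trans (toℚ-+ (n ℕ.+ zB) zB) (cong (_+ qzB) (toℚ-+ n zB)))
                    (toℚ-mono-≤ neighbours)
    slack = ((qn + qzB + qzB) - qm) + (qm - (1ℚ + ε) * qg) + ((qg + qzA) - qn)
            + ε * ((qg + qzA) - qn) + (1ℚ - ε) * qzA + ε + (1ℚ + 1ℚ)
    0≤slack : 0ℚ ≤ slack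
    0≤slack = ℚₚ.+-mono-≤ (ℚₚ.+-mono-≤ (ℚₚ.+-mono-≤ (ℚₚ.+-mono-≤ (ℚₚ.+-mono-≤ (ℚₚ.+-mono-≤
      (0≤q-p neighbours′) (0≤q-p expand)) (0≤q-p cover′)) (0≤p*q 0≤ε (0≤q-p cover′)))
      (0≤p*q (0≤q-p ε≤1) (toℚ-mono-≤ {0} {zA} ℕ.z≤n))) 0≤ε) (ℚₚ.nonNegative⁻¹ (1ℚ + 1ℚ))

module ExpanderBound {n : ℕ} (E : BipGraph n) (ZA ZB : Subset n)
                     {ε : ℚ.ℚ} (0≤ε : ℚ.0ℚ ℚ.≤ ε) (ε≤1 : ε ℚ.≤ ℚ.1ℚ)
                     (expander : IsBipExpander ε E) (separator : IsSeparator E (ZA , ZB)) where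

  open FiniteSets
  open SeparatedGraph E ZA ZB
  open RationalBounds
  open NatSearch
  open import Data.Nat using (suc; _+_; _≤_; _<_; z≤n; s≤s; ⌊_/2⌋; ⌈_/2⌉; _≤?_)
  import Data.Nat.Properties as ℕₚ
  open import Data.Nat.Solver using (module +-*-Solver)
  open import Data.Fin.Properties using (toℕ<n)
  open import Data.Product using (_,_; proj₂)
  open import Data.Sum using (_⊎_; inj₁; inj₂)
  open import Data.Vec using (tabulate)
  open import Relation.Binary.PropositionalEquality
  open import Relation.Nullary using (¬_; yes; no)
  open +-*-Solver using (solve; _:+_; _:=_; con)

  h : ℕ
  h = ⌊ n /2⌋

  h+h≤n : h + h ≤ n
  h+h≤n = subst (h + h ≤_) (ℕₚ.⌊n/2⌋+⌈n/2⌉≡n n) (ℕₚ.+-monoʳ-≤ h (ℕₚ.⌊n/2⌋≤⌈n/2⌉ n))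

  n≤h+h+1 : n ≤ h + h + 1
  n≤h+h+1 = begin
    n             ≡⟨ ℕₚ.⌊n/2⌋+⌈n/2⌉≡n n ⟨
    h + ⌈ n /2⌉   ≤⟨ ℕₚ.+-monoʳ-≤ h (ℕₚ.⌊n/2⌋-mono (ℕₚ.n≤1+n (suc n))) ⟩
    h + suc h     ≡⟨ solve 1 (λ h → h :+ (con 1 :+ h) := h :+ h :+ con 1) refl h ⟩
    h + h + 1     ∎
    where open ℕₚ.≤-Reasoning

  zA zB : ℕ
  zA = card ZAᶠ
  zB = card ZBᶠ

  Goal : Set
  Goal = (ε ℚ.* ℚ.½) ℚ.* (toℚ n ℚ.- ℚ.1ℚ) ℚ.- ℚ.1ℚ ℚ.≤ toℚ zA ℚ.+ toℚ zB

  expansion : ∀ X → card X ≤ h → (ℚ.1ℚ ℚ.+ ε) ℚ.* toℚ (card X) ℚ.≤ toℚ (card (𝒩 X))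
  expansion X ∣X∣≤h = subst₂ (λ s t → (ℚ.1ℚ ℚ.+ ε) ℚ.* toℚ s ℚ.≤ toℚ t) (card-tabulate X) (card-N X)
    (expander (tabulate X) (half-≤ (subst (ℚ._≤ toℚ n) (toℚ-+ ∣ tabulate X ∣ _)
      (toℚ-mono-≤ (subst (λ s → s + s ≤ n) (sym (card-tabulate X))
        (ℕₚ.≤-trans (ℕₚ.+-mono-≤ ∣X∣≤h ∣X∣≤h) h+h≤n))))))

  large-component : ∀ k → h < card (component k) → Goal
  large-component k h<∣C∣ with ⊆-of-card (component k) (ℕₚ.≤-trans (ℕₚ.n≤1+n h) h<∣C∣)
                             | card-nonempty (component k) (ℕₚ.≤-trans (s≤s z≤n) h<∣C∣)
  ... | T , T⊆C , ∣T∣≡h | _ , a∈C =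
    bound-from-large-component ε n h (card (𝒩 T)) zA zB 0≤ε expands separated n≤h+h+1
    where
    C = component k
    expands : (ℚ.1ℚ ℚ.+ ε) ℚ.* toℚ h ℚ.≤ toℚ (card (𝒩 T))
    expands = subst (λ s → (ℚ.1ℚ ℚ.+ ε) ℚ.* toℚ s ℚ.≤ toℚ (card (𝒩 T))) ∣T∣≡h
                (expansion T (ℕₚ.≤-reflexive ∣T∣≡h))
    separated : card (𝒩 T) + h + 1 ≤ n + zB
    separated = begin
      card (𝒩 T) + h + 1               ≡⟨ solve 2 (λ t h → t :+ h :+ con 1 := t :+ (con 1 :+ h)) refl _ h ⟩
      card (𝒩 T) + suc h               ≤⟨ ℕₚ.+-mono-≤ (card≤card─+card (𝒩 T) ZBᶠ) h<∣C∣ ⟩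
      card (𝒩 T ─ ZBᶠ) + zB + card C   ≤⟨ ℕₚ.+-monoˡ-≤ (card C) (ℕₚ.+-monoˡ-≤ zB (card-mono-⊆ {X = 𝒩 T ─ ZBᶠ}
                                             (─-monoˡ-⊆ {X = 𝒩 T} {𝒩 C} {ZBᶠ} (𝒩-mono T⊆C)))) ⟩
      card (𝒩 C ─ ZBᶠ) + zB + card C   ≡⟨ solve 3 (λ d z c → d :+ z :+ c := c :+ d :+ z) refl _ zB (card C) ⟩
      card C + card (𝒩 C ─ ZBᶠ) + zB   ≤⟨ ℕₚ.+-monoˡ-≤ zB (component-bound separator a∈C) ⟩
      n + zB                           ∎
      where open ℕₚ.≤-Reasoning

  small-parts : ∀ k → let P = prefix k ; P′ = prefix (suc k) in
    card P ≤ h → card (P′ ─ P) ≤ h → card (freeA ─ P′) ≤ h → Goal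
  small-parts k P≤h P′─P≤h rest≤h = bound-from-small-parts ε n g m zA zB 0≤ε ε≤1 expand
    (card-cover P P′ ZAᶠ)
    (card-𝒩-three-parts (prefix-closed k) (prefix-closed (suc k)) (∈-∪⁺ˡ {X = P} {component k})
                        (prefix⊆freeA (suc k)))
    where
    P = prefix k
    P′ = prefix (suc k)
    g = card P + card (P′ ─ P) + card (freeA ─ P′)
    m = card (𝒩 P) + card (𝒩 (P′ ─ P)) + card (𝒩 (freeA ─ P′))
    expand : (ℚ.1ℚ ℚ.+ ε) ℚ.* toℚ g ℚ.≤ toℚ m
    expand = scaled-toℚ-+ (ℚ.1ℚ ℚ.+ ε) {card P + card (P′ ─ P)} {card (𝒩 P) + card (𝒩 (P′ ─ P))}
      (scaled-toℚ-+ (ℚ.1ℚ ℚ.+ ε) {card P} {card (𝒩 P)} (expansion P P≤h) (expansion (P′ ─ P) P′─P≤h))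
      (expansion (freeA ─ P′) rest≤h)

  rest-small : ∀ k → ¬ card (prefix (suc k)) ≤ h ⊎ k ≡ n → card (freeA ─ prefix (suc k)) ≤ h
  rest-small k (inj₁ P′≰h) = ℕₚ.+-cancelʳ-≤ (suc h) (card R) h (begin
    card R + suc h     ≤⟨ ℕₚ.+-monoʳ-≤ (card R) (ℕₚ.≰⇒> P′≰h) ⟩
    card R + card P′   ≤⟨ card-disjoint-∪ {X = R} (λ {a} a∈R → proj₂ (∈-─⁻ freeA P′ a∈R)) ⟩
    card (R ∪ P′)      ≤⟨ card≤n (R ∪ P′) ⟩
    n                  ≤⟨ n≤h+h+1 ⟩
    h + h + 1          ≡⟨ solve 1 (λ h → h :+ h :+ con 1 := h :+ (con 1 :+ h)) refl h ⟩
    h + suc h          ∎)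
    where
    open ℕₚ.≤-Reasoning
    P′ = prefix (suc k)
    R = freeA ─ P′
  rest-small k (inj₂ refl) = subst (_≤ h) (sym (card-empty R R-empty)) z≤n
    where
    R = freeA ─ prefix (suc n)
    R-empty : ∀ a → a ∉ R
    R-empty a a∈R = let a-free , a∉P′ = ∈-─⁻ freeA (prefix (suc n)) a∈R
                    in a∉P′ (freeA⊆prefix (suc n) (ℕₚ.m≤n⇒m≤1+n (toℕ<n a)) a-free)

  bound : Goal
  bound with last-before-failure (λ k → card (prefix k) ≤ h) (λ k → card (prefix k) ≤? h)
               (subst (_≤ h) (sym (card-∅ n)) z≤n) n
  ... | k , P≤h , stop with card (prefix (suc k) ─ prefix k) ≤? h
  ...   | yes P′─P≤h = small-parts k P≤h P′─P≤h (rest-small k stop)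
  ...   | no  P′─P≰h = large-component k (ℕₚ.<-≤-trans (ℕₚ.≰⇒> P′─P≰h)
                         (card-mono-⊆ {X = prefix (suc k) ─ prefix k} (prefix-step⊆component k)))

open FiniteSets using (card; card-lookup)
open RationalBounds using (toℚ-+)
open import Data.Rational using (ℚ; 0ℚ; 1ℚ; ½; _≤_; _<_; _*_; _-_; _+_)
open import Data.Rational.Properties using (<⇒≤)
open import Data.Vec using (lookup)
open import Relation.Binary.PropositionalEquality using (_≡_; subst; sym; trans; cong; cong₂)

toℚ-size : ∀ {n} (ZA ZB : Subset n) → toℚ (card (lookup ZA)) + toℚ (card (lookup ZB)) ≡ toℚ (size (ZA , ZB))
toℚ-size ZA ZB = trans (sym (toℚ-+ (card (lookup ZA)) (card (lookup ZB))))
  (cong toℚ (cong₂ ℕ._+_ (card-lookup ZA) (card-lookup ZB)))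

lemma14 : (ε : ℚ) → 0ℚ < ε → ε ≤ 1ℚ →
    (n : ℕ) (E : BipGraph n) → IsBipExpander ε E →
    (Z : VSet n) → IsSeparator E Z →
    (ε * ½) * (toℚ n - 1ℚ) - 1ℚ ≤ toℚ (size Z)
lemma14 ε 0<ε ε≤1 n E expander (ZA , ZB) separator =
  subst ((ε * ½) * (toℚ n - 1ℚ) - 1ℚ ≤_) (toℚ-size ZA ZB)
    (ExpanderBound.bound E ZA ZB (<⇒≤ 0<ε) ε≤1 expander separator)
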